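{- For all raw terms $t,t',u$ and every variable $x_{s(u)}$ whose tag equals the tag $s(u)$ of $u$: if $t\rhd_{\beta\varepsilon} t'$ then $t[x_{s(u)}\setminus u]\rhd_{\beta\varepsilon}^* t'[x_{s(u)}\setminus u]$. Consequently, if $t=_{\beta\varepsilon}t'$ then $t[x_{s(u)}\setminus u]=_{\beta\varepsilon}t'[x_{s(u)}\setminus u]$.
   Context: Sorts are $\mathsf{Prop}$ and $\mathsf{Type}(i)$ for $i\in\mathbb N$. Tags are $*$ and $\diamond$; every variable carries a tag. Raw terms are generated by $t ::= s \mid x_{\mathsf s} \mid \lambda x_{\mathsf s}:t.\,t \mid (t\;t) \mid \Pi x_{\mathsf s}:t.\,t \mid \Sigma^{\mathsf s} x_{\mathsf s}:t.\,t \mid \langle t,t\rangle_{\Sigma^{\mathsf s}x_{\mathsf s}:t.\,t} \mid \pi_1(t) \mid \pi_2^{\mathsf s}(t) \mid \varepsilon$ ($s$ a sort, $\mathsf s$ a tag, $\varepsilon$ a constant), up to $\alpha$-conversion; $t[x\setminus u]$ is capture-avoiding substitution; contextual closure means rewriting at any subterm. Extraction $\rhd_\varepsilon$ is the contextual closure of $x_*\rhd_\varepsilon\varepsilon$, $\lambda x:A.\varepsilon\rhd_\varepsilon\varepsilon$, $(\varepsilon\;t)\rhd_\varepsilon\varepsilon$, $\pi_2^*(t)\rhd_\varepsilon\varepsilon$. The tag $s(t)$ is $*$ if $t\rhd_\varepsilon^*\varepsilon$ and $\diamond$ otherwise. $\rhd_\beta$ is the contextual closure of $((\lambda x_{\mathsf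 s}:A.t)\;u)\rhd_\beta t[x_{\mathsf s}\setminus u]$ if $s(u)=\mathsf s$; $\pi_1(\langle a,b\rangle_{\Sigma^{\mathsf s'}x:A.B})\rhd_\beta a$ if $s(a)=\diamond$; $\pi_2^{\mathsf s}(\langle a,b\rangle_{\Sigma^{\mathsf s'}x:A.B})\rhd_\beta b$ if $s(b)=\mathsf s$. $\rhd_{\beta\varepsilon}=\rhd_\beta\cup\rhd_\varepsilon$, $\rhd_{\beta\varepsilon}^*$ its reflexive-transitive closure, $=_{\beta\varepsilon}$ its reflexive-symmetric-transitive closure. -}

module Defs where

open import Data.Nat using (ℕ; zero; suc)
open import Data.Bool using (Bool; true; false; if_then_else_; _∧_)
open import Data.Sum using (_⊎_)
open import Relation.Nullary using (¬_)
open import Relation.Binary.Construct.Closure.ReflexiveTransitive using (Star)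
open import Relation.Binary.Construct.Closure.Equivalence using (EqClosure)

data Tag : Set where
  ⋆ ◇ : Tag

_=ᵗ_ : Tag → Tag → Bool
⋆ =ᵗ ⋆ = true
◇ =ᵗ ◇ = true
_ =ᵗ _ = false

_=ⁿ_ : ℕ → ℕ → Bool
zero =ⁿ zero = true
suc m =ⁿ suc n = m =ⁿ n
_ =ⁿ _ = false

data Sort : Set where
  Prop : Sort
  Type : ℕ → Sort

-- Raw terms up to α-conversion, via de Bruijn indices with one namespace per tag:
-- var s n is the n-th enclosing binder of tag s (counting only binders of tag s),
-- or a free variable of tag s if there are fewer than n+1 such binders.
data Term : Set where
  sort  : Sort → Term
  var   : Tag → ℕ → Term
  lam   : Tag → Term → Term → Term           -- λ x_s : A . t      (t under binder of tag s)
  app   : Term → Term → Term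
  pi    : Tag → Term → Term → Term           -- Π x_s : A . B
  sig   : Tag → Term → Term → Term           -- Σ^s x_s : A . B
  pair  : Term → Term → Tag → Term → Term → Term  -- ⟨a , b⟩_{Σ^s x_s : A . B}
  proj1 : Term → Term
  proj2 : Tag → Term → Term
  eps   : Term

Ren : Set
Ren = Tag → ℕ → ℕ

Sub : Set
Sub = Tag → ℕ → Term

liftR : Tag → Ren → Ren
liftR s ρ s' n with s =ᵗ s' | n
... | true  | zero  = zero
... | true  | suc m = suc (ρ s' m)
... | false | m     = ρ s' m

rename : Ren → Term → Term
rename ρ (sort x) = sort x
rename ρ (var s n) = var s (ρ s n)
rename ρ (lam s A t) = lam s (rename ρ A) (rename (liftR s ρ) t)
rename ρ (app t u) = app (rename ρ t) (rename ρ u)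
rename ρ (pi s A B) = pi s (rename ρ A) (rename (liftR s ρ) B)
rename ρ (sig s A B) = sig s (rename ρ A) (rename (liftR s ρ) B)
rename ρ (pair a b s A B) = pair (rename ρ a) (rename ρ b) s (rename ρ A) (rename (liftR s ρ) B)
rename ρ (proj1 t) = proj1 (rename ρ t)
rename ρ (proj2 s t) = proj2 s (rename ρ t)
rename ρ eps = eps

weaken : Tag → Term → Term
weaken s = rename (λ s' n → if s =ᵗ s' then suc n else n)

exts : Tag → Sub → Sub
exts s σ s' n with s =ᵗ s' | n
... | true  | zero  = var s' zero
... | true  | suc m = weaken s (σ s' m)
... | false | m     = weaken s (σ s' m)

subst : Sub → Term → Term
subst σ (sort x) = sort x
subst σ (var s n) = σ s n
subst σ (lam s A t) = lam s (subst σ A) (subst (exts s σ) t)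
subst σ (app t u) = app (subst σ t) (subst σ u)
subst σ (pi s A B) = pi s (subst σ A) (subst (exts s σ) B)
subst σ (sig s A B) = sig s (subst σ A) (subst (exts s σ) B)
subst σ (pair a b s A B) = pair (subst σ a) (subst σ b) s (subst σ A) (subst (exts s σ) B)
subst σ (proj1 t) = proj1 (subst σ t)
subst σ (proj2 s t) = proj2 s (subst σ t)
subst σ eps = eps

-- t [ x_s ≔ u ] for the (free) variable x_s = var s k : replace it by u, all other
-- variables unchanged (named capture-avoiding substitution).
_[_,_≔_] : Term → Tag → ℕ → Term → Term
t [ s , k ≔ u ] = subst (λ s' n → if (s =ᵗ s') ∧ (k =ⁿ n) then u else var s' n) t

_[0_≔_] : Term → Tag → Term → Term
t [0 s ≔ u ] = subst σ t
  where
  σ : Sub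
  σ s' n with s =ᵗ s' | n
  ... | true  | zero  = u
  ... | true  | suc m = var s' m
  ... | false | m     = var s' m

data Ctx (R : Term → Term → Set) : Term → Term → Set where
  base   : ∀ {t t'} → R t t' → Ctx R t t'
  lam₁   : ∀ {s A A' t} → Ctx R A A' → Ctx R (lam s A t) (lam s A' t)
  lam₂   : ∀ {s A t t'} → Ctx R t t' → Ctx R (lam s A t) (lam s A t')
  app₁   : ∀ {t t' u} → Ctx R t t' → Ctx R (app t u) (app t' u)
  app₂   : ∀ {t u u'} → Ctx R u u' → Ctx R (app t u) (app t u')
  pi₁    : ∀ {s A A' B} → Ctx R A A' → Ctx R (pi s A B) (pi s A' B)
  pi₂    : ∀ {s A B B'} → Ctx R B B' → Ctx R (pi s A B) (pi s A B')
  sig₁   : ∀ {s A A' B} → Ctx R A A' → Ctx R (sig s A B) (sig s A' B)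
  sig₂   : ∀ {s A B B'} → Ctx R B B' → Ctx R (sig s A B) (sig s A B')
  pair₁  : ∀ {a a' b s A B} → Ctx R a a' → Ctx R (pair a b s A B) (pair a' b s A B)
  pair₂  : ∀ {a b b' s A B} → Ctx R b b' → Ctx R (pair a b s A B) (pair a b' s A B)
  pair₃  : ∀ {a b s A A' B} → Ctx R A A' → Ctx R (pair a b s A B) (pair a b s A' B)
  pair₄  : ∀ {a b s A B B'} → Ctx R B B' → Ctx R (pair a b s A B) (pair a b s A B')
  proj1₁ : ∀ {t t'} → Ctx R t t' → Ctx R (proj1 t) (proj1 t')
  proj2₁ : ∀ {s t t'} → Ctx R t t' → Ctx R (proj2 s t) (proj2 s t')

data EpsBase : Term → Term → Set where
  ε-var  : ∀ {n} → EpsBase (var ⋆ n) eps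
  ε-lam  : ∀ {s A} → EpsBase (lam s A eps) eps
  ε-app  : ∀ {t} → EpsBase (app eps t) eps
  ε-proj : ∀ {t} → EpsBase (proj2 ⋆ t) eps

_▷ε_ : Term → Term → Set
_▷ε_ = Ctx EpsBase

_▷ε*_ : Term → Term → Set
_▷ε*_ = Star _▷ε_

-- TagOf t s  means  s(t) = s
TagOf : Term → Tag → Set
TagOf t ⋆ = t ▷ε* eps
TagOf t ◇ = ¬ (t ▷ε* eps)

data BetaBase : Term → Term → Set where
  β-app : ∀ {s A t u} → TagOf u s → BetaBase (app (lam s A t) u) (t [0 s ≔ u ])
  β-π₁  : ∀ {a b s A B} → TagOf a ◇ → BetaBase (proj1 (pair a b s A B)) a
  β-π₂  : ∀ {s a b s' A B} → TagOf b s → BetaBase (proj2 s (pair a b s' A B)) b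

BetaEpsBase : Term → Term → Set
BetaEpsBase t t' = BetaBase t t' ⊎ EpsBase t t'

_▷βε_ : Term → Term → Set
_▷βε_ = Ctx BetaEpsBase

_▷βε*_ : Term → Term → Set
_▷βε*_ = Star _▷βε_

_=βε_ : Term → Term → Set
_=βε_ = EqClosure _▷βε_

module Submission where

-- The statement holds for every simultaneous substitution σ that
-- is *tag-respecting*, i.e. σ maps each variable of tag s to a term of tag s.
--   1. Substitution algebra: the usual fusion laws of renaming and
--      substitution, culminating in the commutation of σ with β-substitution,
--      σ (t[0 s ≔ u]) ≡ (exts s σ t)[0 s ≔ σ u].
--   2. Tags are syntactic: s(t) = ⋆ exactly when the Boolean `erasable t`
--      holds (a ⋆-variable, π₂^⋆, ε, or λ/application spines ending in one).
--      Hence tag-respecting substitutions preserve tags.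
--   3. Every base β-redex stays a redex of the same kind after σ (by 1 and 2,
--      its side condition on tags survives); the extraction step x_⋆ ▷ ε
--      becomes σ(x_⋆) ▷ε* ε, since σ(x_⋆) has tag ⋆.
-- The single-variable substitution t [ s , k ≔ u ] is tag-respecting as
-- soon as s(u) = s, which yields the theorem.

open import Defs
open import Data.Nat using (ℕ; zero; suc)
open import Data.Bool using (Bool; true; false; if_then_else_; _∧_)
open import Data.Product using (_×_; _,_)
open import Data.Sum using (inj₁; inj₂)
open import Data.Empty using (⊥-elim)
open import Relation.Binary.PropositionalEquality
  using (_≡_; refl; sym; trans; cong; cong₂; module ≡-Reasoning) renaming (subst to ≡-subst)
open import Relation.Binary.Construct.Closure.ReflexiveTransitive
  using (ε; _◅_; _◅◅_; return) renaming (gmap to star-gmap; map to star-map)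
open import Relation.Binary.Construct.Closure.Symmetric using (fwd)
import Relation.Binary.Construct.Closure.Equivalence as EqClosure

-- 1. Substitution algebra

_≗ʳ_ : Ren → Ren → Set
ρ ≗ʳ ρ' = ∀ s n → ρ s n ≡ ρ' s n

_≗ˢ_ : Sub → Sub → Set
σ ≗ˢ τ = ∀ s n → σ s n ≡ τ s n

_∘ʳ_ : Ren → Ren → Ren
(ρ ∘ʳ ρ') s n = ρ s (ρ' s n)

_ˢ∘ʳ_ : Sub → Ren → Sub
(σ ˢ∘ʳ ρ) s n = σ s (ρ s n)

_ʳ∘ˢ_ : Ren → Sub → Sub
(ρ ʳ∘ˢ σ) s n = rename ρ (σ s n)

_∘ˢ_ : Sub → Sub → Sub
(σ ∘ˢ τ) s n = subst σ (τ s n)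

shift : Tag → Ren
shift s s' n = if s =ᵗ s' then suc n else n

pair-cong : ∀ {a a' b b' s A A' B B'} → a ≡ a' → b ≡ b' → A ≡ A' → B ≡ B' →
            pair a b s A B ≡ pair a' b' s A' B'
pair-cong refl refl refl refl = refl

liftR-cong : ∀ s {ρ ρ'} → ρ ≗ʳ ρ' → liftR s ρ ≗ʳ liftR s ρ'
liftR-cong ⋆ eq ⋆ zero    = refl
liftR-cong ⋆ eq ⋆ (suc m) = cong suc (eq ⋆ m)
liftR-cong ⋆ eq ◇ m       = eq ◇ m
liftR-cong ◇ eq ⋆ m       = eq ⋆ m
liftR-cong ◇ eq ◇ zero    = refl
liftR-cong ◇ eq ◇ (suc m) = cong suc (eq ◇ m)

rename-cong : ∀ {ρ ρ'} → ρ ≗ʳ ρ' → ∀ t → rename ρ t ≡ rename ρ' t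
rename-cong eq (sort x)         = refl
rename-cong eq (var s n)        = cong (var s) (eq s n)
rename-cong eq (lam s A t)      = cong₂ (lam s) (rename-cong eq A) (rename-cong (liftR-cong s eq) t)
rename-cong eq (app t u)        = cong₂ app (rename-cong eq t) (rename-cong eq u)
rename-cong eq (pi s A B)       = cong₂ (pi s) (rename-cong eq A) (rename-cong (liftR-cong s eq) B)
rename-cong eq (sig s A B)      = cong₂ (sig s) (rename-cong eq A) (rename-cong (liftR-cong s eq) B)
rename-cong eq (pair a b s A B) =
  pair-cong (rename-cong eq a) (rename-cong eq b) (rename-cong eq A) (rename-cong (liftR-cong s eq) B)
rename-cong eq (proj1 t)        = cong proj1 (rename-cong eq t)
rename-cong eq (proj2 s t)      = cong (proj2 s) (rename-cong eq t)
rename-cong eq eps              = refl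

exts-cong : ∀ s {σ τ} → σ ≗ˢ τ → exts s σ ≗ˢ exts s τ
exts-cong ⋆ eq ⋆ zero    = refl
exts-cong ⋆ eq ⋆ (suc m) = cong (weaken ⋆) (eq ⋆ m)
exts-cong ⋆ eq ◇ m       = cong (weaken ⋆) (eq ◇ m)
exts-cong ◇ eq ⋆ m       = cong (weaken ◇) (eq ⋆ m)
exts-cong ◇ eq ◇ zero    = refl
exts-cong ◇ eq ◇ (suc m) = cong (weaken ◇) (eq ◇ m)

subst-cong : ∀ {σ τ} → σ ≗ˢ τ → ∀ t → subst σ t ≡ subst τ t
subst-cong eq (sort x)         = refl
subst-cong eq (var s n)        = eq s n
subst-cong eq (lam s A t)      = cong₂ (lam s) (subst-cong eq A) (subst-cong (exts-cong s eq) t)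
subst-cong eq (app t u)        = cong₂ app (subst-cong eq t) (subst-cong eq u)
subst-cong eq (pi s A B)       = cong₂ (pi s) (subst-cong eq A) (subst-cong (exts-cong s eq) B)
subst-cong eq (sig s A B)      = cong₂ (sig s) (subst-cong eq A) (subst-cong (exts-cong s eq) B)
subst-cong eq (pair a b s A B) =
  pair-cong (subst-cong eq a) (subst-cong eq b) (subst-cong eq A) (subst-cong (exts-cong s eq) B)
subst-cong eq (proj1 t)        = cong proj1 (subst-cong eq t)
subst-cong eq (proj2 s t)      = cong (proj2 s) (subst-cong eq t)
subst-cong eq eps              = refl

-- Fusion of two renamings.  Each fusion law comes with its instance under a
-- binder, which is where the interaction with liftR/exts is resolved.
liftR-∘ʳ : ∀ s ρ ρ' → (liftR s ρ ∘ʳ liftR s ρ') ≗ʳ liftR s (ρ ∘ʳ ρ')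
liftR-∘ʳ ⋆ ρ ρ' ⋆ zero    = refl
liftR-∘ʳ ⋆ ρ ρ' ⋆ (suc m) = refl
liftR-∘ʳ ⋆ ρ ρ' ◇ m       = refl
liftR-∘ʳ ◇ ρ ρ' ⋆ m       = refl
liftR-∘ʳ ◇ ρ ρ' ◇ zero    = refl
liftR-∘ʳ ◇ ρ ρ' ◇ (suc m) = refl

rename-rename : ∀ ρ ρ' t → rename ρ (rename ρ' t) ≡ rename (ρ ∘ʳ ρ') t
rename-rename-under : ∀ s ρ ρ' t →
  rename (liftR s ρ) (rename (liftR s ρ') t) ≡ rename (liftR s (ρ ∘ʳ ρ')) t

rename-rename ρ ρ' (sort x)         = refl
rename-rename ρ ρ' (var s n)        = refl
rename-rename ρ ρ' (lam s A t)      = cong₂ (lam s) (rename-rename ρ ρ' A) (rename-rename-under s ρ ρ' t)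
rename-rename ρ ρ' (app t u)        = cong₂ app (rename-rename ρ ρ' t) (rename-rename ρ ρ' u)
rename-rename ρ ρ' (pi s A B)       = cong₂ (pi s) (rename-rename ρ ρ' A) (rename-rename-under s ρ ρ' B)
rename-rename ρ ρ' (sig s A B)      = cong₂ (sig s) (rename-rename ρ ρ' A) (rename-rename-under s ρ ρ' B)
rename-rename ρ ρ' (pair a b s A B) =
  pair-cong (rename-rename ρ ρ' a) (rename-rename ρ ρ' b) (rename-rename ρ ρ' A) (rename-rename-under s ρ ρ' B)
rename-rename ρ ρ' (proj1 t)        = cong proj1 (rename-rename ρ ρ' t)
rename-rename ρ ρ' (proj2 s t)      = cong (proj2 s) (rename-rename ρ ρ' t)
rename-rename ρ ρ' eps              = refl

rename-rename-under s ρ ρ' t = trans (rename-rename (liftR s ρ) (liftR s ρ') t) (rename-cong (liftR-∘ʳ s ρ ρ') t)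

exts-ˢ∘ʳ : ∀ s σ ρ → (exts s σ ˢ∘ʳ liftR s ρ) ≗ˢ exts s (σ ˢ∘ʳ ρ)
exts-ˢ∘ʳ ⋆ σ ρ ⋆ zero    = refl
exts-ˢ∘ʳ ⋆ σ ρ ⋆ (suc m) = refl
exts-ˢ∘ʳ ⋆ σ ρ ◇ m       = refl
exts-ˢ∘ʳ ◇ σ ρ ⋆ m       = refl
exts-ˢ∘ʳ ◇ σ ρ ◇ zero    = refl
exts-ˢ∘ʳ ◇ σ ρ ◇ (suc m) = refl

subst-rename : ∀ σ ρ t → subst σ (rename ρ t) ≡ subst (σ ˢ∘ʳ ρ) t
subst-rename-under : ∀ s σ ρ t →
  subst (exts s σ) (rename (liftR s ρ) t) ≡ subst (exts s (σ ˢ∘ʳ ρ)) t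

subst-rename σ ρ (sort x)         = refl
subst-rename σ ρ (var s n)        = refl
subst-rename σ ρ (lam s A t)      = cong₂ (lam s) (subst-rename σ ρ A) (subst-rename-under s σ ρ t)
subst-rename σ ρ (app t u)        = cong₂ app (subst-rename σ ρ t) (subst-rename σ ρ u)
subst-rename σ ρ (pi s A B)       = cong₂ (pi s) (subst-rename σ ρ A) (subst-rename-under s σ ρ B)
subst-rename σ ρ (sig s A B)      = cong₂ (sig s) (subst-rename σ ρ A) (subst-rename-under s σ ρ B)
subst-rename σ ρ (pair a b s A B) =
  pair-cong (subst-rename σ ρ a) (subst-rename σ ρ b) (subst-rename σ ρ A) (subst-rename-under s σ ρ B)
subst-rename σ ρ (proj1 t)        = cong proj1 (subst-rename σ ρ t)
subst-rename σ ρ (proj2 s t)      = cong (proj2 s) (subst-rename σ ρ t)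
subst-rename σ ρ eps              = refl

subst-rename-under s σ ρ t = trans (subst-rename (exts s σ) (liftR s ρ) t) (subst-cong (exts-ˢ∘ʳ s σ ρ) t)

-- Renaming after substitution; under a binder it reduces to the fact that
-- a lifted renaming commutes with weakening.
rename-weaken : ∀ s ρ t → rename (liftR s ρ) (weaken s t) ≡ weaken s (rename ρ t)
rename-weaken s ρ t = begin
  rename (liftR s ρ) (weaken s t)   ≡⟨ rename-rename (liftR s ρ) (shift s) t ⟩
  rename (liftR s ρ ∘ʳ shift s) t   ≡⟨ rename-cong (lift-shift s) t ⟩
  rename (shift s ∘ʳ ρ) t           ≡⟨ sym (rename-rename (shift s) ρ t) ⟩
  weaken s (rename ρ t)             ∎
  where
  open ≡-Reasoning
  lift-shift : ∀ s → (liftR s ρ ∘ʳ shift s) ≗ʳ (shift s ∘ʳ ρ)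
  lift-shift ⋆ ⋆ n = refl
  lift-shift ⋆ ◇ n = refl
  lift-shift ◇ ⋆ n = refl
  lift-shift ◇ ◇ n = refl

exts-ʳ∘ˢ : ∀ s ρ σ → (liftR s ρ ʳ∘ˢ exts s σ) ≗ˢ exts s (ρ ʳ∘ˢ σ)
exts-ʳ∘ˢ ⋆ ρ σ ⋆ zero    = refl
exts-ʳ∘ˢ ⋆ ρ σ ⋆ (suc m) = rename-weaken ⋆ ρ (σ ⋆ m)
exts-ʳ∘ˢ ⋆ ρ σ ◇ m       = rename-weaken ⋆ ρ (σ ◇ m)
exts-ʳ∘ˢ ◇ ρ σ ⋆ m       = rename-weaken ◇ ρ (σ ⋆ m)
exts-ʳ∘ˢ ◇ ρ σ ◇ zero    = refl
exts-ʳ∘ˢ ◇ ρ σ ◇ (suc m) = rename-weaken ◇ ρ (σ ◇ m)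

rename-subst : ∀ ρ σ t → rename ρ (subst σ t) ≡ subst (ρ ʳ∘ˢ σ) t
rename-subst-under : ∀ s ρ σ t →
  rename (liftR s ρ) (subst (exts s σ) t) ≡ subst (exts s (ρ ʳ∘ˢ σ)) t

rename-subst ρ σ (sort x)         = refl
rename-subst ρ σ (var s n)        = refl
rename-subst ρ σ (lam s A t)      = cong₂ (lam s) (rename-subst ρ σ A) (rename-subst-under s ρ σ t)
rename-subst ρ σ (app t u)        = cong₂ app (rename-subst ρ σ t) (rename-subst ρ σ u)
rename-subst ρ σ (pi s A B)       = cong₂ (pi s) (rename-subst ρ σ A) (rename-subst-under s ρ σ B)
rename-subst ρ σ (sig s A B)      = cong₂ (sig s) (rename-subst ρ σ A) (rename-subst-under s ρ σ B)
rename-subst ρ σ (pair a b s A B) =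
  pair-cong (rename-subst ρ σ a) (rename-subst ρ σ b) (rename-subst ρ σ A) (rename-subst-under s ρ σ B)
rename-subst ρ σ (proj1 t)        = cong proj1 (rename-subst ρ σ t)
rename-subst ρ σ (proj2 s t)      = cong (proj2 s) (rename-subst ρ σ t)
rename-subst ρ σ eps              = refl

rename-subst-under s ρ σ t = trans (rename-subst (liftR s ρ) (exts s σ) t) (subst-cong (exts-ʳ∘ˢ s ρ σ) t)

-- Composition of two substitutions; under a binder it reduces to the fact
-- that an extended substitution commutes with weakening.
subst-weaken : ∀ s σ t → subst (exts s σ) (weaken s t) ≡ weaken s (subst σ t)
subst-weaken s σ t = begin
  subst (exts s σ) (weaken s t)      ≡⟨ subst-rename (exts s σ) (shift s) t ⟩
  subst (exts s σ ˢ∘ʳ shift s) t     ≡⟨ subst-cong (exts-shift s) t ⟩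
  subst (shift s ʳ∘ˢ σ) t            ≡⟨ sym (rename-subst (shift s) σ t) ⟩
  weaken s (subst σ t)               ∎
  where
  open ≡-Reasoning
  exts-shift : ∀ s → (exts s σ ˢ∘ʳ shift s) ≗ˢ (shift s ʳ∘ˢ σ)
  exts-shift ⋆ ⋆ n = refl
  exts-shift ⋆ ◇ n = refl
  exts-shift ◇ ⋆ n = refl
  exts-shift ◇ ◇ n = refl

exts-∘ˢ : ∀ s σ τ → (exts s σ ∘ˢ exts s τ) ≗ˢ exts s (σ ∘ˢ τ)
exts-∘ˢ ⋆ σ τ ⋆ zero    = refl
exts-∘ˢ ⋆ σ τ ⋆ (suc m) = subst-weaken ⋆ σ (τ ⋆ m)
exts-∘ˢ ⋆ σ τ ◇ m       = subst-weaken ⋆ σ (τ ◇ m)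
exts-∘ˢ ◇ σ τ ⋆ m       = subst-weaken ◇ σ (τ ⋆ m)
exts-∘ˢ ◇ σ τ ◇ zero    = refl
exts-∘ˢ ◇ σ τ ◇ (suc m) = subst-weaken ◇ σ (τ ◇ m)

subst-subst : ∀ σ τ t → subst σ (subst τ t) ≡ subst (σ ∘ˢ τ) t
subst-subst-under : ∀ s σ τ t →
  subst (exts s σ) (subst (exts s τ) t) ≡ subst (exts s (σ ∘ˢ τ)) t

subst-subst σ τ (sort x)         = refl
subst-subst σ τ (var s n)        = refl
subst-subst σ τ (lam s A t)      = cong₂ (lam s) (subst-subst σ τ A) (subst-subst-under s σ τ t)
subst-subst σ τ (app t u)        = cong₂ app (subst-subst σ τ t) (subst-subst σ τ u)
subst-subst σ τ (pi s A B)       = cong₂ (pi s) (subst-subst σ τ A) (subst-subst-under s σ τ B)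
subst-subst σ τ (sig s A B)      = cong₂ (sig s) (subst-subst σ τ A) (subst-subst-under s σ τ B)
subst-subst σ τ (pair a b s A B) =
  pair-cong (subst-subst σ τ a) (subst-subst σ τ b) (subst-subst σ τ A) (subst-subst-under s σ τ B)
subst-subst σ τ (proj1 t)        = cong proj1 (subst-subst σ τ t)
subst-subst σ τ (proj2 s t)      = cong (proj2 s) (subst-subst σ τ t)
subst-subst σ τ eps              = refl

subst-subst-under s σ τ t = trans (subst-subst (exts s σ) (exts s τ) t) (subst-cong (exts-∘ˢ s σ τ) t)

exts-id : ∀ s {σ} → σ ≗ˢ var → exts s σ ≗ˢ var
exts-id ⋆ eq ⋆ zero    = refl
exts-id ⋆ eq ⋆ (suc m) = cong (weaken ⋆) (eq ⋆ m)
exts-id ⋆ eq ◇ m       = cong (weaken ⋆) (eq ◇ m)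
exts-id ◇ eq ⋆ m       = cong (weaken ◇) (eq ⋆ m)
exts-id ◇ eq ◇ zero    = refl
exts-id ◇ eq ◇ (suc m) = cong (weaken ◇) (eq ◇ m)

subst-id : ∀ {σ} → σ ≗ˢ var → ∀ t → subst σ t ≡ t
subst-id eq (sort x)         = refl
subst-id eq (var s n)        = eq s n
subst-id eq (lam s A t)      = cong₂ (lam s) (subst-id eq A) (subst-id (exts-id s eq) t)
subst-id eq (app t u)        = cong₂ app (subst-id eq t) (subst-id eq u)
subst-id eq (pi s A B)       = cong₂ (pi s) (subst-id eq A) (subst-id (exts-id s eq) B)
subst-id eq (sig s A B)      = cong₂ (sig s) (subst-id eq A) (subst-id (exts-id s eq) B)
subst-id eq (pair a b s A B) = pair-cong (subst-id eq a) (subst-id eq b) (subst-id eq A) (subst-id (exts-id s eq) B)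
subst-id eq (proj1 t)        = cong proj1 (subst-id eq t)
subst-id eq (proj2 s t)      = cong (proj2 s) (subst-id eq t)
subst-id eq eps              = refl

β-sub : Tag → Term → Sub
β-sub s u s' n = var s' n [0 s ≔ u ]

β-weaken : ∀ s u t → subst (β-sub s u) (weaken s t) ≡ t
β-weaken s u t = trans (subst-rename (β-sub s u) (shift s) t) (subst-id (β-shift s) t)
  where
  β-shift : ∀ s → (β-sub s u ˢ∘ʳ shift s) ≗ˢ var
  β-shift ⋆ ⋆ n = refl
  β-shift ⋆ ◇ n = refl
  β-shift ◇ ⋆ n = refl
  β-shift ◇ ◇ n = refl

subst-β : ∀ σ s t u → subst σ (t [0 s ≔ u ]) ≡ (subst (exts s σ) t) [0 s ≔ subst σ u ]
subst-β σ s t u = begin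
  subst σ (t [0 s ≔ u ])                            ≡⟨ subst-subst σ (β-sub s u) t ⟩
  subst (σ ∘ˢ β-sub s u) t                          ≡⟨ subst-cong (β-exts s) t ⟩
  subst (β-sub s (subst σ u) ∘ˢ exts s σ) t         ≡⟨ sym (subst-subst (β-sub s (subst σ u)) (exts s σ) t) ⟩
  (subst (exts s σ) t) [0 s ≔ subst σ u ]           ∎
  where
  open ≡-Reasoning
  β-exts : ∀ s → (σ ∘ˢ β-sub s u) ≗ˢ (β-sub s (subst σ u) ∘ˢ exts s σ)
  β-exts ⋆ ⋆ zero    = refl
  β-exts ⋆ ⋆ (suc m) = sym (β-weaken ⋆ _ (σ ⋆ m))
  β-exts ⋆ ◇ m       = sym (β-weaken ⋆ _ (σ ◇ m))
  β-exts ◇ ⋆ m       = sym (β-weaken ◇ _ (σ ⋆ m))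
  β-exts ◇ ◇ zero    = refl
  β-exts ◇ ◇ (suc m) = sym (β-weaken ◇ _ (σ ◇ m))

-- 2. Tags are decided syntactically

-- `erasable t` holds iff t ▷ε* ε: the extraction rules only ever fire at a
-- ⋆-variable, π₂^⋆, ε itself, or along a λ-body / application head.
erasable : Term → Bool
erasable (sort _)         = false
erasable (var ⋆ n)        = true
erasable (var ◇ n)        = false
erasable (lam s A t)      = erasable t
erasable (app t u)        = erasable t
erasable (pi _ _ _)       = false
erasable (sig _ _ _)      = false
erasable (pair _ _ _ _ _) = false
erasable (proj1 _)        = false
erasable (proj2 ⋆ t)      = true
erasable (proj2 ◇ t)      = false
erasable eps              = true

isStar : Tag → Bool
isStar ⋆ = true
isStar ◇ = false

erasable-step : ∀ {t t'} → t ▷ε t' → erasable t ≡ erasable t'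
erasable-step (base ε-var)        = refl
erasable-step (base ε-lam)        = refl
erasable-step (base ε-app)        = refl
erasable-step (base ε-proj)       = refl
erasable-step (lam₁ p)            = refl
erasable-step (lam₂ p)            = erasable-step p
erasable-step (app₁ p)            = erasable-step p
erasable-step (app₂ p)            = refl
erasable-step (pi₁ p)             = refl
erasable-step (pi₂ p)             = refl
erasable-step (sig₁ p)            = refl
erasable-step (sig₂ p)            = refl
erasable-step (pair₁ p)           = refl
erasable-step (pair₂ p)           = refl
erasable-step (pair₃ p)           = refl
erasable-step (pair₄ p)           = refl
erasable-step (proj1₁ p)          = refl
erasable-step (proj2₁ {⋆} p)      = refl
erasable-step (proj2₁ {◇} p)      = refl

erasable-steps : ∀ {t t'} → t ▷ε* t' → erasable t ≡ erasable t'
erasable-steps ε        = refl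
erasable-steps (p ◅ ps) = trans (erasable-step p) (erasable-steps ps)

erasable⇒▷ε* : ∀ t → erasable t ≡ true → t ▷ε* eps
erasable⇒▷ε* (var ⋆ n)   _ = return (base ε-var)
erasable⇒▷ε* (lam s A t) e = star-gmap (lam s A) lam₂ (erasable⇒▷ε* t e) ◅◅ return (base ε-lam)
erasable⇒▷ε* (app t u)   e = star-gmap (λ f → app f u) app₁ (erasable⇒▷ε* t e) ◅◅ return (base ε-app)
erasable⇒▷ε* (proj2 ⋆ t) _ = return (base ε-proj)
erasable⇒▷ε* eps         _ = ε
erasable⇒▷ε* (sort _)         ()
erasable⇒▷ε* (var ◇ n)        ()
erasable⇒▷ε* (pi _ _ _)       ()
erasable⇒▷ε* (sig _ _ _)      ()
erasable⇒▷ε* (pair _ _ _ _ _) ()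
erasable⇒▷ε* (proj1 _)        ()
erasable⇒▷ε* (proj2 ◇ t)      ()

tag⇒erasable : ∀ t s → TagOf t s → erasable t ≡ isStar s
tag⇒erasable t ⋆ t▷ε = erasable-steps t▷ε
tag⇒erasable t ◇ t⋫ε with erasable t in e
... | true  = ⊥-elim (t⋫ε (erasable⇒▷ε* t e))
... | false = refl

erasable⇒tag : ∀ t s → erasable t ≡ isStar s → TagOf t s
erasable⇒tag t ⋆ e = erasable⇒▷ε* t e
erasable⇒tag t ◇ e t▷ε with trans (sym e) (erasable-steps t▷ε)
... | ()

-- 3. Tag-respecting substitutions preserve tags

TagRespecting : Sub → Set
TagRespecting σ = ∀ s n → erasable (σ s n) ≡ isStar s

erasable-rename : ∀ ρ t → erasable (rename ρ t) ≡ erasable t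
erasable-rename ρ (sort x)         = refl
erasable-rename ρ (var ⋆ n)        = refl
erasable-rename ρ (var ◇ n)        = refl
erasable-rename ρ (lam s A t)      = erasable-rename (liftR s ρ) t
erasable-rename ρ (app t u)        = erasable-rename ρ t
erasable-rename ρ (pi s A B)       = refl
erasable-rename ρ (sig s A B)      = refl
erasable-rename ρ (pair a b s A B) = refl
erasable-rename ρ (proj1 t)        = refl
erasable-rename ρ (proj2 ⋆ t)      = refl
erasable-rename ρ (proj2 ◇ t)      = refl
erasable-rename ρ eps              = refl

exts-respecting : ∀ s σ → TagRespecting σ → TagRespecting (exts s σ)
exts-respecting ⋆ σ r ⋆ zero    = refl
exts-respecting ⋆ σ r ⋆ (suc m) = trans (erasable-rename _ (σ ⋆ m)) (r ⋆ m)
exts-respecting ⋆ σ r ◇ m       = trans (erasable-rename _ (σ ◇ m)) (r ◇ m)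
exts-respecting ◇ σ r ⋆ m       = trans (erasable-rename _ (σ ⋆ m)) (r ⋆ m)
exts-respecting ◇ σ r ◇ zero    = refl
exts-respecting ◇ σ r ◇ (suc m) = trans (erasable-rename _ (σ ◇ m)) (r ◇ m)

erasable-subst : ∀ σ → TagRespecting σ → ∀ t → erasable (subst σ t) ≡ erasable t
erasable-subst σ r (sort x)         = refl
erasable-subst σ r (var ⋆ n)        = r ⋆ n
erasable-subst σ r (var ◇ n)        = r ◇ n
erasable-subst σ r (lam s A t)      = erasable-subst (exts s σ) (exts-respecting s σ r) t
erasable-subst σ r (app t u)        = erasable-subst σ r t
erasable-subst σ r (pi s A B)       = refl
erasable-subst σ r (sig s A B)      = refl
erasable-subst σ r (pair a b s A B) = refl
erasable-subst σ r (proj1 t)        = refl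
erasable-subst σ r (proj2 ⋆ t)      = refl
erasable-subst σ r (proj2 ◇ t)      = refl
erasable-subst σ r eps              = refl

tag-subst : ∀ σ → TagRespecting σ → ∀ t s → TagOf t s → TagOf (subst σ t) s
tag-subst σ r t s tag =
  erasable⇒tag (subst σ t) s (trans (erasable-subst σ r t) (tag⇒erasable t s tag))

-- 4. Reduction and conversion are stable under tag-respecting substitution

ctx-map : ∀ {R R' : Term → Term → Set} → (∀ {a b} → R a b → R' a b) →
          ∀ {a b} → Ctx R a b → Ctx R' a b
ctx-map f (base p)   = base (f p)
ctx-map f (lam₁ p)   = lam₁ (ctx-map f p)
ctx-map f (lam₂ p)   = lam₂ (ctx-map f p)
ctx-map f (app₁ p)   = app₁ (ctx-map f p)
ctx-map f (app₂ p)   = app₂ (ctx-map f p)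
ctx-map f (pi₁ p)    = pi₁ (ctx-map f p)
ctx-map f (pi₂ p)    = pi₂ (ctx-map f p)
ctx-map f (sig₁ p)   = sig₁ (ctx-map f p)
ctx-map f (sig₂ p)   = sig₂ (ctx-map f p)
ctx-map f (pair₁ p)  = pair₁ (ctx-map f p)
ctx-map f (pair₂ p)  = pair₂ (ctx-map f p)
ctx-map f (pair₃ p)  = pair₃ (ctx-map f p)
ctx-map f (pair₄ p)  = pair₄ (ctx-map f p)
ctx-map f (proj1₁ p) = proj1₁ (ctx-map f p)
ctx-map f (proj2₁ p) = proj2₁ (ctx-map f p)

▷ε*⇒▷βε* : ∀ {a b} → a ▷ε* b → a ▷βε* b
▷ε*⇒▷βε* = star-map (ctx-map inj₂)

-- A base βε-step after substitution: a β-redex stays a β-redex (its tag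
-- side condition is preserved), and x_⋆ ▷ ε becomes σ(x_⋆) ▷ε* ε.
base-subst : ∀ σ → TagRespecting σ → ∀ {t t'} → BetaEpsBase t t' → subst σ t ▷βε* subst σ t'
base-subst σ r (inj₁ (β-app {s} {A} {t} {u} tag)) =
  ≡-subst (subst σ (app (lam s A t) u) ▷βε*_) (sym (subst-β σ s t u))
    (return (base (inj₁ (β-app (tag-subst σ r u s tag)))))
base-subst σ r (inj₁ (β-π₁ {a} tag))         = return (base (inj₁ (β-π₁ (tag-subst σ r a ◇ tag))))
base-subst σ r (inj₁ (β-π₂ {s} {b = b} tag)) = return (base (inj₁ (β-π₂ (tag-subst σ r b s tag))))
base-subst σ r (inj₂ (ε-var {n}))            = ▷ε*⇒▷βε* (erasable⇒▷ε* (σ ⋆ n) (r ⋆ n))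
base-subst σ r (inj₂ ε-lam)                  = return (base (inj₂ ε-lam))
base-subst σ r (inj₂ ε-app)                  = return (base (inj₂ ε-app))
base-subst σ r (inj₂ ε-proj)                 = return (base (inj₂ ε-proj))

step-subst : ∀ σ → TagRespecting σ → ∀ {t t'} → t ▷βε t' → subst σ t ▷βε* subst σ t'
step-subst σ r (base p)              = base-subst σ r p
step-subst σ r (lam₁ p)              = star-gmap _ lam₁ (step-subst σ r p)
step-subst σ r (lam₂ {s} p)          = star-gmap _ lam₂ (step-subst (exts s σ) (exts-respecting s σ r) p)
step-subst σ r (app₁ p)              = star-gmap _ app₁ (step-subst σ r p)
step-subst σ r (app₂ p)              = star-gmap _ app₂ (step-subst σ r p)
step-subst σ r (pi₁ p)               = star-gmap _ pi₁ (step-subst σ r p)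
step-subst σ r (pi₂ {s} p)           = star-gmap _ pi₂ (step-subst (exts s σ) (exts-respecting s σ r) p)
step-subst σ r (sig₁ p)              = star-gmap _ sig₁ (step-subst σ r p)
step-subst σ r (sig₂ {s} p)          = star-gmap _ sig₂ (step-subst (exts s σ) (exts-respecting s σ r) p)
step-subst σ r (pair₁ p)             = star-gmap _ pair₁ (step-subst σ r p)
step-subst σ r (pair₂ p)             = star-gmap _ pair₂ (step-subst σ r p)
step-subst σ r (pair₃ p)             = star-gmap _ pair₃ (step-subst σ r p)
step-subst σ r (pair₄ {s = s} p)     = star-gmap _ pair₄ (step-subst (exts s σ) (exts-respecting s σ r) p)
step-subst σ r (proj1₁ p)            = star-gmap _ proj1₁ (step-subst σ r p)
step-subst σ r (proj2₁ p)            = star-gmap _ proj2₁ (step-subst σ r p)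

conv-subst : ∀ σ → TagRespecting σ → ∀ {t t'} → t =βε t' → subst σ t =βε subst σ t'
conv-subst σ r = EqClosure.gfold (EqClosure.isEquivalence _▷βε_) (subst σ)
                   (λ p → star-map fwd (step-subst σ r p))

single-respecting : ∀ u s k → TagOf u s →
  TagRespecting (λ s' n → if (s =ᵗ s') ∧ (k =ⁿ n) then u else var s' n)
single-respecting u ⋆ k tag ⋆ n with k =ⁿ n
... | true  = tag⇒erasable u ⋆ tag
... | false = refl
single-respecting u ⋆ k tag ◇ n = refl
single-respecting u ◇ k tag ⋆ n = refl
single-respecting u ◇ k tag ◇ n with k =ⁿ n
... | true  = tag⇒erasable u ◇ tag
... | false = refl

lemma3p8 : (t t' u : Term) (s : Tag) (k : ℕ) → TagOf u s →
             (t ▷βε t' → (t [ s , k ≔ u ]) ▷βε* (t' [ s , k ≔ u ]))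
             × (t =βε t' → (t [ s , k ≔ u ]) =βε (t' [ s , k ≔ u ]))
lemma3p8 t t' u s k tag = step-subst _ respecting , conv-subst _ respecting
  where
  respecting : TagRespecting (λ s' n → if (s =ᵗ s') ∧ (k =ⁿ n) then u else var s' n)
  respecting = single-respecting u s k tag
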